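{- Let $\Pi_q$ be a projective plane of order $q$ and let $B_1,B_2$ be point sets of types $T_1$ and $T_2$ respectively. Suppose that $\{t-1,t+1: t\in T_1\}\cap T_2=\emptyset$. Then the symmetric difference $B_1\triangle B_2$ has no tangent line, i.e., no line meets $B_1\triangle B_2$ in exactly one point.
   Context: A projective plane of order $q$ has $q^2+q+1$ points and lines, each line has $q+1$ points, two points lie on a unique line and two lines meet in a unique point. The type of a point set $B$ is the set $\{|B\cap\ell|:\ell \text{ a line}\}$ of its line intersection numbers. -}

module Defs where

open import Data.Nat using (ℕ; suc; _+_; _*_; _≤_)
open import Data.Fin using (Fin)
open import Data.Bool using (Bool; true; false; _∧_; _xor_)
open import Data.Fin.Subset using (Subset)
open import Data.Vec using (lookup; tabulate)
open import Data.Product using (Σ; ∃; ∃-syntax; _×_)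
open import Relation.Binary.PropositionalEquality using (_≡_)
open import Relation.Nullary using (¬_)

count : ∀ {n} → (Fin n → Bool) → ℕ
count {n} f = Data.Fin.Subset.∣_∣ (tabulate f)

record ProjectivePlane (q : ℕ) : Set where
  field
    order≥2 : 2 ≤ q
    _I_ : Fin (q * q + q + 1) → Fin (q * q + q + 1) → Bool
  Point : Set
  Point = Fin (q * q + q + 1)
  Line : Set
  Line = Fin (q * q + q + 1)
  field
    line-size : ∀ (ℓ : Line) → count (λ P → P I ℓ) ≡ q + 1
    two-points : ∀ (P Q : Point) → ¬ (P ≡ Q) →
      Σ Line λ ℓ → (P I ℓ ≡ true × Q I ℓ ≡ true) ×
        (∀ m → P I m ≡ true → Q I m ≡ true → m ≡ ℓ)
    two-lines : ∀ (ℓ m : Line) → ¬ (ℓ ≡ m) →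
      Σ Point λ P → (P I ℓ ≡ true × P I m ≡ true) ×
        (∀ Q → Q I ℓ ≡ true → Q I m ≡ true → Q ≡ P)

module _ {q : ℕ} (Π : ProjectivePlane q) where
  open ProjectivePlane Π

  meet : Subset (q * q + q + 1) → Line → ℕ
  meet B ℓ = count (λ P → lookup B P ∧ (P I ℓ))

  InType : Subset (q * q + q + 1) → ℕ → Set
  InType B t = ∃[ ℓ ] meet B ℓ ≡ t

  symDiff : Subset (q * q + q + 1) → Subset (q * q + q + 1) → Subset (q * q + q + 1)
  symDiff B₁ B₂ = tabulate (λ P → lookup B₁ P xor lookup B₂ P)

{-# OPTIONS --safe #-}
-- On a line ℓ the points of B₁ △ B₂ are those lying in exactly one of B₁ ∩ ℓ
-- and B₂ ∩ ℓ. If there is just one such point, the two intersections agree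
-- everywhere else, so |B₁ ∩ ℓ| and |B₂ ∩ ℓ| differ by exactly one, putting
-- some t ∈ T₁ next to t ± 1 ∈ T₂.
module Submission where

open import Defs
open import Data.Nat using (ℕ; zero; suc; _+_; _*_; pred)
open import Data.Fin using (Fin)
open import Data.Fin.Subset using (Subset)
open import Data.Bool using (Bool; true; false; _∧_; _xor_)
open import Data.Bool.Properties using (∧-distribʳ-xor)
open import Data.Vec using (lookup)
open import Data.Vec.Properties using (lookup∘tabulate; tabulate-cong)
open import Data.Sum using (_⊎_; inj₁; inj₂)
open import Data.Product using (_,_)
open import Function using (_∘_)
open import Relation.Binary.PropositionalEquality using (_≡_; _≗_; refl; sym; trans; cong)
open import Relation.Nullary using (¬_)

count-cong : ∀ {n} {f g : Fin n → Bool} → f ≗ g → count f ≡ count g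
count-cong = cong Data.Fin.Subset.∣_∣ ∘ tabulate-cong

count-xor≡0⇒count≡ : ∀ {n} (f g : Fin n → Bool) →
  count (λ i → f i xor g i) ≡ 0 → count f ≡ count g
count-xor≡0⇒count≡ {zero}  f g _ = refl
count-xor≡0⇒count≡ {suc n} f g h with f Fin.zero | g Fin.zero
... | true  | true  = cong suc (count-xor≡0⇒count≡ (f ∘ Fin.suc) (g ∘ Fin.suc) h)
... | false | false = count-xor≡0⇒count≡ (f ∘ Fin.suc) (g ∘ Fin.suc) h

count-xor≡1⇒count-adjacent : ∀ {n} (f g : Fin n → Bool) →
  count (λ i → f i xor g i) ≡ 1 →
  count f ≡ suc (count g) ⊎ count g ≡ suc (count f)
count-xor≡1⇒count-adjacent {zero}  f g ()
count-xor≡1⇒count-adjacent {suc n} f g h with f Fin.zero | g Fin.zero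
... | true  | true  with count-xor≡1⇒count-adjacent (f ∘ Fin.suc) (g ∘ Fin.suc) h
...   | inj₁ f>g = inj₁ (cong suc f>g)
...   | inj₂ g>f = inj₂ (cong suc g>f)
count-xor≡1⇒count-adjacent {suc n} f g h | false | false =
  count-xor≡1⇒count-adjacent (f ∘ Fin.suc) (g ∘ Fin.suc) h
count-xor≡1⇒count-adjacent {suc n} f g h | true  | false =
  inj₁ (cong suc (count-xor≡0⇒count≡ (f ∘ Fin.suc) (g ∘ Fin.suc) (cong pred h)))
count-xor≡1⇒count-adjacent {suc n} f g h | false | true  =
  inj₂ (cong suc (sym (count-xor≡0⇒count≡ (f ∘ Fin.suc) (g ∘ Fin.suc) (cong pred h))))

module _ {q : ℕ} (Π : ProjectivePlane q) where
  open ProjectivePlane Π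

  meet-symDiff : ∀ B₁ B₂ ℓ →
    meet Π (symDiff Π B₁ B₂) ℓ ≡
      count (λ P → (lookup B₁ P ∧ (P I ℓ)) xor (lookup B₂ P ∧ (P I ℓ)))
  meet-symDiff B₁ B₂ ℓ = count-cong λ P →
    trans (cong (_∧ (P I ℓ)) (lookup∘tabulate _ P))
          (∧-distribʳ-xor (P I ℓ) (lookup B₁ P) (lookup B₂ P))

  tangent-of-symDiff⇒meet-adjacent : ∀ B₁ B₂ ℓ → meet Π (symDiff Π B₁ B₂) ℓ ≡ 1 →
    meet Π B₁ ℓ ≡ suc (meet Π B₂ ℓ) ⊎ meet Π B₂ ℓ ≡ suc (meet Π B₁ ℓ)
  tangent-of-symDiff⇒meet-adjacent B₁ B₂ ℓ tangent =
    count-xor≡1⇒count-adjacent (λ P → lookup B₁ P ∧ (P I ℓ)) (λ P → lookup B₂ P ∧ (P I ℓ))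
      (trans (sym (meet-symDiff B₁ B₂ ℓ)) tangent)

mainTheorem7 : (q : ℕ) (Π : ProjectivePlane q) (B₁ B₂ : Subset (q * q + q + 1)) →
    -- {t-1, t+1 : t ∈ T₁} ∩ T₂ = ∅ (for t = 0, t-1 = -1 is never in T₂)
    (∀ t → InType Π B₁ t → ¬ InType Π B₂ (suc t)) →
    (∀ t → InType Π B₁ (suc t) → ¬ InType Π B₂ t) →
    ∀ ℓ → ¬ (meet Π (symDiff Π B₁ B₂) ℓ ≡ 1)
mainTheorem7 q Π B₁ B₂ no-up no-down ℓ tangent
  with tangent-of-symDiff⇒meet-adjacent Π B₁ B₂ ℓ tangent
... | inj₁ B₁-above = no-down _ (ℓ , B₁-above) (ℓ , refl)
... | inj₂ B₂-above = no-up _ (ℓ , refl) (ℓ , B₂-above)
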